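{- Let $p$ and $q$ be distinct primes and $\xi=\log q/\log p$. If $(a,b)\in\mathcal U(\xi)$, the following are equivalent: (i) $p^a/q^b$ has no non-trivial biased factorization; (ii) $(a,b)$ is irreducible with respect to $\xi$; (iii) $(a,b)\in\mathcal G\cap\mathcal U_2(\xi)$. Similarly, if $(a,b)\in\mathcal L(\xi)$, the following are equivalent: (i) $p^a/q^b$ has no non-trivial biased factorization; (ii) $(a,b)$ is irreducible with respect to $\xi$; (iii) $(a,b)\in\mathcal G\cap\mathcal L_1(\xi)$.
   Context: $\mathbb N_0=\{0,1,2,\dots\}$, $\mathcal N=\{(a,b)\in\mathbb N_0^2:(a,b)\neq(0,0)\}$ with componentwise addition, $\mathcal G=\{(a,b)\in\mathcal N:\gcd(a,b)=1\}$ (convention $\gcd(a,0)=a$; $a/0=\infty$ for $a\in\mathbb N$). For positive irrational $\xi$: $\mathcal U(\xi)=\{(a,b)\in\mathcal N:a>b\xi\}$, $\mathcal L(\xi)=\{(a,b)\in\mathcal N:a<b\xi\}$, $\mathcal U_2(\xi)=\{(a,b)\in\mathcal U(\xi): a/b=\min\{m/n:(m,n)\in\mathcal U(\xi),\ n\le b\}\}$, $\mathcal L_1(\xi)=\{(a,b)\in\mathcal L(\xi): a/b=\max\{m/n:(m,n)\in\mathcal L(\xi),\ m\le a\}\}$. A point $x\in\mathcal U(\xi)$ (resp. $\mathcal L(\xi)$) is reducible with respect to $\xi$ if $x=y+z$ with $y,z\in\mathcal U(\xi)$ (resp. $y,z\in\mathcal L(\xi)$); otherwise irreducible. For a positive rational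 $\alpha\ne1$, a factorization of $\alpha$ is a tuple $(r_1/s_1,\dots,r_N/s_N)$ with $\prod r_n/s_n=\alpha$, $r_n,s_n\in\mathbb N$, $r_n/s_n\ne1$, and $\gcd(r_m,s_n)=1$ for all $m,n$. It is biased if either $r_n>s_n$ for all $n$ or $r_n<s_n$ for all $n$. The trivial factorization is $(\alpha)$; a non-trivial factorization is any other one (equivalently one with $N\ge2$). -}

module Defs where

open import Data.Nat using (ℕ; zero; suc; _+_; _*_; _^_; _≤_; _<_)
open import Data.Nat.GCD using (gcd)
open import Data.Nat.Coprimality using (Coprime)
open import Data.Product using (_×_; _,_; proj₁; proj₂; ∃-syntax)
open import Data.Sum using (_⊎_)
open import Data.List using (List; map; length)
open import Data.Nat.ListAction using (product)
open import Data.List.Relation.Unary.All using (All)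
open import Data.List.Membership.Propositional using (_∈_)
open import Relation.Binary.PropositionalEquality using (_≡_; _≢_)
open import Relation.Nullary using (¬_)

Pt : Set
Pt = ℕ × ℕ

_⊕_ : Pt → Pt → Pt
(a , b) ⊕ (c , d) = (a + c , b + d)

InN : Pt → Set
InN (a , b) = ¬ (a ≡ 0 × b ≡ 0)

-- 𝒢 : gcd(a,b) = 1 (stdlib: gcd a 0 = a, matching the paper's convention)
InG : Pt → Set
InG (a , b) = InN (a , b) × gcd a b ≡ 1

-- With ξ = log q / log p (p, q distinct primes):
--   a > b ξ  ⟺  a log p > b log q  ⟺  p^a > q^b.
InU : ℕ → ℕ → Pt → Set
InU p q (a , b) = InN (a , b) × q ^ b < p ^ a

InL : ℕ → ℕ → Pt → Set
InL p q (a , b) = InN (a , b) × p ^ a < q ^ b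

-- a/b ≤ m/n with the convention x/0 = ∞ (x ≥ 1), expressed by cross-multiplication.
-- 𝒰₂(ξ): a/b is the minimum of {m/n : (m,n) ∈ 𝒰(ξ), n ≤ b}
-- (the point (a,b) itself belongs to this set, so "= min" means "≤ every element").
InU2 : ℕ → ℕ → Pt → Set
InU2 p q (a , b) = InU p q (a , b) ×
  (∀ m n → InU p q (m , n) → n ≤ b → a * n ≤ m * b)

InL1 : ℕ → ℕ → Pt → Set
InL1 p q (a , b) = InL p q (a , b) ×
  (∀ m n → InL p q (m , n) → m ≤ a → m * b ≤ a * n)

ReducibleU : ℕ → ℕ → Pt → Set
ReducibleU p q x = ∃[ y ] ∃[ z ] (InU p q y × InU p q z × x ≡ y ⊕ z)

ReducibleL : ℕ → ℕ → Pt → Set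
ReducibleL p q x = ∃[ y ] ∃[ z ] (InL p q y × InL p q z × x ≡ y ⊕ z)

IrreducibleU : ℕ → ℕ → Pt → Set
IrreducibleU p q x = InU p q x × ¬ ReducibleU p q x

IrreducibleL : ℕ → ℕ → Pt → Set
IrreducibleL p q x = InL p q x × ¬ ReducibleL p q x

-- A factorization of α = p^a / q^b: a tuple (r₁/s₁, …, r_N/s_N), represented as a
-- list of pairs (r , s) of positive naturals with r ≠ s, ∏ r / ∏ s = p^a / q^b,
-- and gcd(r_m, s_n) = 1 for all m, n.
IsFactorization : ℕ → ℕ → Pt → List (ℕ × ℕ) → Set
IsFactorization p q (a , b) fs =
  All (λ rs → 0 < proj₁ rs × 0 < proj₂ rs × proj₁ rs ≢ proj₂ rs) fs ×
  (product (map proj₁ fs) * q ^ b ≡ p ^ a * product (map proj₂ fs)) ×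
  (∀ r s → r ∈ map proj₁ fs → s ∈ map proj₂ fs → Coprime r s)

Biased : List (ℕ × ℕ) → Set
Biased fs = All (λ rs → proj₂ rs < proj₁ rs) fs ⊎ All (λ rs → proj₁ rs < proj₂ rs) fs

NonTrivial : List (ℕ × ℕ) → Set
NonTrivial fs = 2 ≤ length fs

NoNontrivialBiasedFactorization : ℕ → ℕ → Pt → Set
NoNontrivialBiasedFactorization p q x =
  ¬ (∃[ fs ] (IsFactorization p q x fs × Biased fs × NonTrivial fs))

{-# OPTIONS --safe #-}
module Submission where

-- (i) ⇔ (ii): since p and q are distinct primes, coprimality of numerators and denominators
-- forces every factor of a factorization of p ^ a / q ^ b to be p ^ i / q ^ j. A non-trivial
-- factorization biased upwards is therefore a decomposition (a , b) = (i , j) + (a − i , b − j)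
-- into points of 𝒰(ξ), while one biased downwards has product below 1 and cannot occur.
--
-- (ii) ⇔ (iii): a common divisor k ≥ 2 of a and b splits (a , b) as (a , b)/k + (k − 1)(a , b)/k.
-- A point (m , n) ∈ 𝒰(ξ) with n ≤ b and m/n < a/b splits off, leaving (a − m , b − n), which is
-- steeper than (a , b) and so again in 𝒰(ξ). Conversely, if (a , b) is primitive of minimal slope,
-- both summands of a decomposition have slope exactly a/b, so each is a positive multiple of
-- (a , b), which is absurd.
--
-- The ℒ(ξ) statement is the 𝒰(ξ) statement for 1/ξ: exchange p and q, the two coordinates of
-- every point, and numerator and denominator of every factor.

open import Defs
open import Data.Nat
  using (ℕ; zero; suc; _+_; _*_; _∸_; _^_; _≤_; _<_; z≤n; s≤s; _≤?_; _<?_; NonZero; ≢-nonZero; nonTrivial⇒n>1)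
open import Data.Nat.Primality using (Prime; prime⇒irreducible; prime⇒nonZero; prime⇒nonTrivial)
open import Data.Product using (_×_; _,_; proj₁; proj₂; ∃-syntax; swap)
open import Function.Bundles using (_⇔_; mk⇔)
open import Relation.Binary.PropositionalEquality
  using (_≢_; _≡_; refl; sym; trans; cong; cong₂; subst; subst₂; ≢-sym; module ≡-Reasoning)

open import Algebra.Properties.CommutativeSemigroup using (interchange)
open import Data.List using (List; []; _∷_; map)
open import Data.List.Membership.Propositional using (_∈_)
open import Data.List.Properties using (map-∘; length-map)
open import Data.List.Relation.Unary.All as All using (All; []; _∷_; tabulate)
open import Data.List.Relation.Unary.All.Properties using (map⁺)
open import Data.List.Relation.Unary.Any using (here; there)
open import Data.Nat.Coprimality using (Coprime; coprime-divisor; gcd≡1⇒coprime; 1-coprimeTo)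
  renaming (sym to coprime-sym)
open import Data.Nat.Divisibility
  using (_∣_; divides; _∣?_; ∣-trans; ∣⇒≤; ∣1⇒≡1; m∣m*n; ∣m⇒∣m*n; ∣n⇒∣m*n; *-cancelˡ-∣)
open import Data.Nat.GCD using (gcd; gcd[m,n]∣m; gcd[m,n]∣n; gcd-comm)
open import Data.Nat.ListAction using (product)
open import Data.Nat.ListAction.Properties using (∈⇒∣product)
open import Data.Nat.Properties
open import Data.Nat.Solver using (module +-*-Solver)
open import Data.Product.Function.NonDependent.Propositional using (_×-⇔_)
open import Data.Sum using (inj₁; inj₂; [_,_]′)
open import Function using (_∘_; id)
import Function.Properties.Equivalence as ⇔
open import Relation.Nullary using (¬_; yes; no; contradiction)

open +-*-Solver using (solve; _:*_; _:=_; con)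

^-cancelˡ-< : ∀ n {x y} → x ^ n < y ^ n → x < y
^-cancelˡ-< n {x} {y} xⁿ<yⁿ with x <? y
... | yes x<y = x<y
... | no x≮y = contradiction (^-monoˡ-≤ n (≮⇒≥ x≮y)) (<⇒≱ xⁿ<yⁿ)

m^n≡m^o*m^[n∸o] : ∀ m {n o} → o ≤ n → m ^ n ≡ m ^ o * m ^ (n ∸ o)
m^n≡m^o*m^[n∸o] m {n} {o} o≤n =
  trans (cong (m ^_) (sym (m+[n∸m]≡n o≤n))) (^-distribˡ-+-* m o (n ∸ o))

x*c≡d*y∧y<x⇒c<d : ∀ {x y c d} .{{_ : NonZero c}} → x * c ≡ d * y → y < x → c < d
x*c≡d*y∧y<x⇒c<d {x} {y} {c} {d} xc≡dy y<x = *-cancelʳ-< y c d (begin-strict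
  c * y  ≡⟨ *-comm c y ⟩
  y * c  <⟨ *-monoˡ-< c y<x ⟩
  x * c  ≡⟨ xc≡dy ⟩
  d * y  ∎)
  where open ≤-Reasoning

m+m≤m⇒m≡0 : ∀ {m} → m + m ≤ m → m ≡ 0
m+m≤m⇒m≡0 {m} m+m≤m = n≤0⇒n≡0 (+-cancelʳ-≤ m m 0 m+m≤m)

m≤n∧o≤p∧m+o≡n+p⇒m≡n : ∀ {m n o p} → m ≤ n → o ≤ p → m + o ≡ n + p → m ≡ n
m≤n∧o≤p∧m+o≡n+p⇒m≡n {m} {n} {o} {p} m≤n o≤p eq =
  ≤-antisym m≤n (+-cancelʳ-≤ o n m (subst (n + o ≤_) (sym eq) (+-monoʳ-≤ n o≤p)))

product-map-< : ∀ {A : Set} {f g : A → ℕ} x xs → All (λ y → f y < g y) (x ∷ xs) →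
                product (map f (x ∷ xs)) < product (map g (x ∷ xs))
product-map-< x []       (fx<gx ∷ []) = *-monoˡ-< 1 fx<gx
product-map-< x (y ∷ ys) (fx<gx ∷ fys<gys) = *-mono-< fx<gx (product-map-< y ys fys<gys)

coprime-* : ∀ {m n o} → Coprime m n → Coprime m o → Coprime m (n * o)
coprime-* {n = n} m⊥n m⊥o {d} (d∣m , d∣no) = m⊥o (d∣m , coprime-divisor d⊥n d∣no)
  where
  d⊥n : Coprime d n
  d⊥n (e∣d , e∣n) = m⊥n (∣-trans e∣d d∣m , e∣n)

coprime-product : ∀ {m ns} → All (Coprime m) ns → Coprime m (product ns)
coprime-product {m} [] = coprime-sym (1-coprimeTo m)
coprime-product (m⊥n ∷ m⊥ns) = coprime-* m⊥n (coprime-product m⊥ns)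

coprime-^ : ∀ {m n} → Coprime m n → ∀ i j → Coprime (m ^ i) (n ^ j)
coprime-^ m⊥n i j = coprime-sym (coprime-^ʳ (coprime-sym (coprime-^ʳ m⊥n j)) i)
  where
  coprime-^ʳ : ∀ {m n} → Coprime m n → ∀ j → Coprime m (n ^ j)
  coprime-^ʳ {m} m⊥n zero    = coprime-sym (1-coprimeTo m)
  coprime-^ʳ     m⊥n (suc j) = coprime-* m⊥n (coprime-^ʳ m⊥n j)

primes-coprime : ∀ {p q} → Prime p → Prime q → p ≢ q → Coprime p q
primes-coprime p-prime q-prime p≢q (d∣p , d∣q) with prime⇒irreducible p-prime d∣p
... | inj₁ d≡1 = d≡1
... | inj₂ refl =
  [ id , (λ p≡q → contradiction p≡q p≢q) ]′ (prime⇒irreducible q-prime d∣q)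

prime∤⇒coprime : ∀ {p d} → Prime p → ¬ p ∣ d → Coprime d p
prime∤⇒coprime p-prime p∤d (e∣d , e∣p) with prime⇒irreducible p-prime e∣p
... | inj₁ e≡1 = e≡1
... | inj₂ refl = contradiction e∣d p∤d

∣p^n⇒≡p^i : ∀ {p d} → Prime p → ∀ n → d ∣ p ^ n → ∃[ i ] (i ≤ n × d ≡ p ^ i)
∣p^n⇒≡p^i p-prime zero d∣1 = 0 , z≤n , ∣1⇒≡1 d∣1
∣p^n⇒≡p^i {p} {d} p-prime (suc n) d∣p^[1+n] with p ∣? d
... | yes (divides d′ refl) =
  let i , i≤n , d′≡p^i = ∣p^n⇒≡p^i p-prime n
        (*-cancelˡ-∣ p {{prime⇒nonZero p-prime}} (subst (_∣ p ^ suc n) (*-comm d′ p) d∣p^[1+n]))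
  in suc i , s≤s i≤n , trans (cong (_* p) d′≡p^i) (*-comm (p ^ i) p)
... | no p∤d =
  let i , i≤n , d≡p^i = ∣p^n⇒≡p^i p-prime n
        (coprime-divisor (prime∤⇒coprime p-prime p∤d) d∣p^[1+n])
  in i , m≤n⇒m≤1+n i≤n , d≡p^i

coprime-proportional⇒≤ : ∀ {a b c d} → Coprime a b → a * d ≡ c * b → InN (c , d) →
                         a ≤ c × b ≤ d
coprime-proportional⇒≤ {a} {b} {c} {d} a⊥b ad≡cb cd≢0 =
  a≤c a⊥b ad≡cb cd≢0 ,
  a≤c (coprime-sym a⊥b) (trans (*-comm b c) (trans (sym ad≡cb) (*-comm a d))) (cd≢0 ∘ swap)
  where
  a≤c : ∀ {a b c d} → Coprime a b → a * d ≡ c * b → InN (c , d) → a ≤ c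
  a≤c {a} {b} {zero}  {d} _   ad≡0  cd≢0 =
    ≤-reflexive (m*n≡0⇒m≡0 a d {{≢-nonZero (λ d≡0 → cd≢0 (refl , d≡0))}} ad≡0)
  a≤c {a} {b} {suc c} {d} a⊥b ad≡cb _ =
    ∣⇒≤ (coprime-divisor a⊥b (subst (a ∣_) (trans ad≡cb (*-comm (suc c) b)) (m∣m*n d)))

Above : ℕ → ℕ → Pt → Set
Above p q (a , b) = q ^ b < p ^ a

module Slope (p q : ℕ) where

  above⇒InU : ∀ {x} → Above p q x → InU p q x
  above⇒InU {a , b} qᵇ<pᵃ = (λ { (refl , refl) → <-irrefl refl qᵇ<pᵃ }) , qᵇ<pᵃ

  above-* : ∀ a b k .{{_ : NonZero k}} → Above p q (a , b) → Above p q (a * k , b * k)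
  above-* a b k qᵇ<pᵃ = subst₂ _<_ (^-*-assoc q b k) (^-*-assoc p a k) (^-monoˡ-< k qᵇ<pᵃ)

  above-*-cancel : ∀ a b k → Above p q (a * k , b * k) → Above p q (a , b)
  above-*-cancel a b k qᵇᵏ<pᵃᵏ =
    ^-cancelˡ-< k (subst₂ _<_ (sym (^-*-assoc q b k)) (sym (^-*-assoc p a k)) qᵇᵏ<pᵃᵏ)

  above-steeper : 1 < p → ∀ {a b c d} → Above p q (a , b) → a * d < c * b → Above p q (c , d)
  above-steeper 1<p {a} {b} {c} {d} qᵇ<pᵃ ad<cb = ^-cancelˡ-< b (begin-strict
    (q ^ d) ^ b  ≡⟨ ^-*-assoc q d b ⟩
    q ^ (d * b)  ≡⟨ cong (q ^_) (*-comm d b) ⟩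
    q ^ (b * d)  ≡⟨ ^-*-assoc q b d ⟨
    (q ^ b) ^ d  ≤⟨ ^-monoˡ-≤ d (<⇒≤ qᵇ<pᵃ) ⟩
    (p ^ a) ^ d  ≡⟨ ^-*-assoc p a d ⟩
    p ^ (a * d)  <⟨ ^-monoʳ-< p 1<p ad<cb ⟩
    p ^ (c * b)  ≡⟨ ^-*-assoc p c b ⟨
    (p ^ c) ^ b  ∎)
    where open ≤-Reasoning

module Irreducibility (p q : ℕ) (1<p : 1 < p) where
  open Slope p q

  reducible-multiple : ∀ a b k .{{_ : NonZero k}} → Above p q (a , b) →
                       ReducibleU p q (a * suc k , b * suc k)
  reducible-multiple a b k ab =
    (a , b) , (a * k , b * k) , above⇒InU ab , above⇒InU (above-* a b k ab) ,
    cong₂ _,_ (*-suc a k) (*-suc b k)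

  reducible-shallower : ∀ {a b m n} → Above p q (a , b) → Above p q (m , n) → n ≤ b →
                        m * b < a * n → ReducibleU p q (a , b)
  reducible-shallower {a} {b} {m} {n} ab mn n≤b mb<an =
    (m , n) , (a ∸ m , b ∸ n) , above⇒InU mn ,
    above⇒InU (above-steeper 1<p {a} {b} {a ∸ m} {b ∸ n} ab remainder-steeper) ,
    cong₂ _,_ (sym (m+[n∸m]≡n m≤a)) (sym (m+[n∸m]≡n n≤b))
    where
    an≤ab : a * n ≤ a * b
    an≤ab = *-monoʳ-≤ a n≤b
    m≤a : m ≤ a
    m≤a = <⇒≤ (*-cancelʳ-< b m a (<-≤-trans mb<an an≤ab))
    remainder-steeper : a * (b ∸ n) < (a ∸ m) * b
    remainder-steeper = subst₂ _<_ (sym (*-distribˡ-∸ a b n)) (sym (*-distribʳ-∸ b a m))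
                          (∸-monoʳ-< mb<an an≤ab)

  irreducible⇒InG : ∀ {a b} → IrreducibleU p q (a , b) → InG (a , b)
  irreducible⇒InG {a} {b} ((ab≢0 , ab) , irreducible) = ab≢0 , gcd≡1
    where
    gcd≡1 : gcd a b ≡ 1
    gcd≡1 with gcd a b | gcd[m,n]∣m a b | gcd[m,n]∣n a b
    ... | zero | divides a′ a≡ | divides b′ b≡ =
      contradiction (trans a≡ (*-zeroʳ a′) , trans b≡ (*-zeroʳ b′)) ab≢0
    ... | suc zero | _ | _ = refl
    ... | suc (suc k) | divides a′ a≡ | divides b′ b≡ =
      contradiction
        (subst (ReducibleU p q) (sym ab≡)
          (reducible-multiple a′ b′ (suc k)
            (above-*-cancel a′ b′ (suc (suc k)) (subst (Above p q) ab≡ ab))))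
        irreducible
      where ab≡ = cong₂ _,_ a≡ b≡

  irreducible⇒InU2 : ∀ {a b} → IrreducibleU p q (a , b) → InU2 p q (a , b)
  irreducible⇒InU2 {a} {b} (ab∈U , irreducible) = ab∈U , minimal
    where
    minimal : ∀ m n → InU p q (m , n) → n ≤ b → a * n ≤ m * b
    minimal m n (_ , mn) n≤b with a * n ≤? m * b
    ... | yes an≤mb = an≤mb
    ... | no an≰mb =
      contradiction (reducible-shallower {a} {b} {m} {n} (proj₂ ab∈U) mn n≤b (≰⇒> an≰mb)) irreducible

  primitive∧InU2⇒irreducible : ∀ {x} → InG x → InU2 p q x → ¬ ReducibleU p q x
  primitive∧InU2⇒irreducible (ab≢0 , gcd≡1) (_ , minimal)
    ((a₁ , b₁) , (a₂ , b₂) , u₁ , u₂ , refl) = ab≢0 (a≡0 , b≡0)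
    where
    a = a₁ + a₂
    b = b₁ + b₂
    sums : a * b₁ + a * b₂ ≡ a₁ * b + a₂ * b
    sums = trans (sym (*-distribˡ-+ a b₁ b₂)) (*-distribʳ-+ b a₁ a₂)
    eq₁ : a * b₁ ≡ a₁ * b
    eq₁ = m≤n∧o≤p∧m+o≡n+p⇒m≡n
            (minimal a₁ b₁ u₁ (m≤m+n b₁ b₂)) (minimal a₂ b₂ u₂ (m≤n+m b₂ b₁)) sums
    eq₂ : a * b₂ ≡ a₂ * b
    eq₂ = +-cancelˡ-≡ (a₁ * b) _ _ (trans (cong (_+ a * b₂) (sym eq₁)) sums)
    a⊥b = gcd≡1⇒coprime gcd≡1
    a≤a₁,b≤b₁ : a ≤ a₁ × b ≤ b₁
    a≤a₁,b≤b₁ = coprime-proportional⇒≤ a⊥b eq₁ (proj₁ u₁)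
    a≤a₂,b≤b₂ : a ≤ a₂ × b ≤ b₂
    a≤a₂,b≤b₂ = coprime-proportional⇒≤ a⊥b eq₂ (proj₁ u₂)
    a≡0 : a ≡ 0
    a≡0 = m+m≤m⇒m≡0 (+-mono-≤ (proj₁ a≤a₁,b≤b₁) (proj₁ a≤a₂,b≤b₂))
    b≡0 : b ≡ 0
    b≡0 = m+m≤m⇒m≡0 (+-mono-≤ (proj₂ a≤a₁,b≤b₁) (proj₂ a≤a₂,b≤b₂))

  irreducibleU⇔InG×InU2 : ∀ {a b} → IrreducibleU p q (a , b) ⇔ (InG (a , b) × InU2 p q (a , b))
  irreducibleU⇔InG×InU2 = mk⇔
    (λ irreducible → irreducible⇒InG irreducible , irreducible⇒InU2 irreducible)
    (λ (ab∈G , ab∈U2) → proj₁ ab∈U2 , primitive∧InU2⇒irreducible ab∈G ab∈U2)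

NontrivialBiasedFactorization : ℕ → ℕ → Pt → List (ℕ × ℕ) → Set
NontrivialBiasedFactorization p q x fs = IsFactorization p q x fs × Biased fs × NonTrivial fs

numerator∣ : ∀ {p q a b fs r} → IsFactorization p q (a , b) fs → r ∈ map proj₁ fs → r ∣ p ^ a
numerator∣ {p} {q} {a} {b} {fs} {r} (_ , eq , cop) r∈ =
  coprime-divisor (coprime-product (tabulate (cop _ _ r∈)))
    (subst (r ∣_) (trans eq (*-comm (p ^ a) _)) (∣m⇒∣m*n (q ^ b) (∈⇒∣product r∈)))

denominator∣ : ∀ {p q a b fs s} → IsFactorization p q (a , b) fs → s ∈ map proj₂ fs → s ∣ q ^ b
denominator∣ {p} {q} {a} {b} {fs} {s} (_ , eq , cop) s∈ =
  coprime-divisor (coprime-product (tabulate (λ r∈ → coprime-sym (cop _ _ r∈ s∈))))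
    (subst (s ∣_) (sym eq) (∣n⇒∣m*n (p ^ a) (∈⇒∣product s∈)))

IsFactorization-swap : ∀ {p q a b fs} → IsFactorization p q (a , b) fs →
                       IsFactorization q p (b , a) (map swap fs)
IsFactorization-swap {p} {q} {a} {b} {fs} (pos , eq , cop) =
  map⁺ (All.map (λ (r>0 , s>0 , r≢s) → s>0 , r>0 , ≢-sym r≢s) pos) ,
  subst₂ (λ rs ss → product rs * p ^ a ≡ q ^ b * product ss) (map-∘ fs) (map-∘ fs)
    (trans (*-comm _ (p ^ a)) (trans (sym eq) (*-comm _ (q ^ b)))) ,
  λ r s r∈ s∈ →
    coprime-sym (cop s r (subst (s ∈_) (sym (map-∘ fs)) s∈) (subst (r ∈_) (sym (map-∘ fs)) r∈))

Biased-swap : ∀ {fs} → Biased fs → Biased (map swap fs)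
Biased-swap = [ inj₂ ∘ map⁺ , inj₁ ∘ map⁺ ]′

upward-factorization⇒above : ∀ {p q a b f fs} .{{_ : NonZero q}} →
                             IsFactorization p q (a , b) (f ∷ fs) →
                             All (λ rs → proj₂ rs < proj₁ rs) (f ∷ fs) → Above p q (a , b)
upward-factorization⇒above {q = q} {b = b} {f} {fs} (_ , eq , _) up =
  x*c≡d*y∧y<x⇒c<d {{m^n≢0 q b}} eq (product-map-< f fs up)

downward-factorization⇒below : ∀ {p q a b f fs} .{{_ : NonZero p}} →
                               IsFactorization p q (a , b) (f ∷ fs) →
                               All (λ rs → proj₁ rs < proj₂ rs) (f ∷ fs) → Above q p (b , a)
downward-factorization⇒below {p} {q} {a} {b} fact down =
  upward-factorization⇒above {q} {p} {b} {a} (IsFactorization-swap {p} {q} {a} {b} fact) (map⁺ down)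

factorization-tail : ∀ {p q a b i j fs} .{{_ : NonZero p}} .{{_ : NonZero q}} →
                     IsFactorization p q (a , b) ((p ^ i , q ^ j) ∷ fs) → i ≤ a → j ≤ b →
                     IsFactorization p q (a ∸ i , b ∸ j) fs
factorization-tail {p} {q} {a} {b} {i} {j} {fs} (_ ∷ pos , eq , cop) i≤a j≤b =
  pos , tail-eq , λ r s r∈ s∈ → cop r s (there r∈) (there s∈)
  where
  R = product (map proj₁ fs)
  S = product (map proj₂ fs)
  open ≡-Reasoning
  interchange′ = interchange *-commutativeSemigroup
  tail-eq : R * q ^ (b ∸ j) ≡ p ^ (a ∸ i) * S
  tail-eq = *-cancelˡ-≡ _ _ (p ^ i * q ^ j) {{m*n≢0 (p ^ i) (q ^ j) {{m^n≢0 p i}} {{m^n≢0 q j}}}} (begin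
    (p ^ i * q ^ j) * (R * q ^ (b ∸ j))  ≡⟨ interchange′ (p ^ i) (q ^ j) R (q ^ (b ∸ j)) ⟩
    (p ^ i * R) * (q ^ j * q ^ (b ∸ j))  ≡⟨ cong (p ^ i * R *_) (m^n≡m^o*m^[n∸o] q j≤b) ⟨
    (p ^ i * R) * q ^ b                  ≡⟨ eq ⟩
    p ^ a * (q ^ j * S)                  ≡⟨ cong (_* (q ^ j * S)) (m^n≡m^o*m^[n∸o] p i≤a) ⟩
    (p ^ i * p ^ (a ∸ i)) * (q ^ j * S)  ≡⟨ interchange′ (p ^ i) (p ^ (a ∸ i)) (q ^ j) S ⟩
    (p ^ i * q ^ j) * (p ^ (a ∸ i) * S)  ∎)

module Factorizations {p q : ℕ} (p-prime : Prime p) (q-prime : Prime q) (p≢q : p ≢ q) where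
  open Slope p q

  instance
    p≢0 : NonZero p
    p≢0 = prime⇒nonZero p-prime
    q≢0 : NonZero q
    q≢0 = prime⇒nonZero q-prime

  pair-factorization : ∀ {a₁ b₁ a₂ b₂} → Above p q (a₁ , b₁) → Above p q (a₂ , b₂) →
    NontrivialBiasedFactorization p q ((a₁ , b₁) ⊕ (a₂ , b₂)) ((p ^ a₁ , q ^ b₁) ∷ (p ^ a₂ , q ^ b₂) ∷ [])
  pair-factorization {a₁} {b₁} {a₂} {b₂} ab₁ ab₂ =
    (positive , product-eq , coprime) , inj₁ (ab₁ ∷ ab₂ ∷ []) , s≤s (s≤s z≤n)
    where
    positive = (m^n>0 p a₁ , m^n>0 q b₁ , ≢-sym (<⇒≢ ab₁)) ∷
               (m^n>0 p a₂ , m^n>0 q b₂ , ≢-sym (<⇒≢ ab₂)) ∷ []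
    product-eq : (p ^ a₁ * (p ^ a₂ * 1)) * q ^ (b₁ + b₂) ≡ p ^ (a₁ + a₂) * (q ^ b₁ * (q ^ b₂ * 1))
    product-eq rewrite ^-distribˡ-+-* p a₁ a₂ | ^-distribˡ-+-* q b₁ b₂ =
      solve 4 (λ A₁ A₂ B₁ B₂ →
                 (A₁ :* (A₂ :* con 1)) :* (B₁ :* B₂) := (A₁ :* A₂) :* (B₁ :* (B₂ :* con 1)))
        refl (p ^ a₁) (p ^ a₂) (q ^ b₁) (q ^ b₂)
    powers-coprime = coprime-^ (primes-coprime p-prime q-prime p≢q)
    coprime : ∀ r s → r ∈ p ^ a₁ ∷ p ^ a₂ ∷ [] → s ∈ q ^ b₁ ∷ q ^ b₂ ∷ [] → Coprime r s
    coprime _ _ (here refl)         (here refl)         = powers-coprime a₁ b₁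
    coprime _ _ (here refl)         (there (here refl)) = powers-coprime a₁ b₂
    coprime _ _ (there (here refl)) (here refl)         = powers-coprime a₂ b₁
    coprime _ _ (there (here refl)) (there (here refl)) = powers-coprime a₂ b₂

  reducible⇒factorization : ∀ {x} → ReducibleU p q x → ∃[ fs ] NontrivialBiasedFactorization p q x fs
  reducible⇒factorization ((a₁ , b₁) , (a₂ , b₂) , (_ , ab₁) , (_ , ab₂) , refl) =
    _ , pair-factorization {a₁} {b₁} {a₂} {b₂} ab₁ ab₂

  upward-factorization⇒reducible : ∀ {a b f g fs} → IsFactorization p q (a , b) (f ∷ g ∷ fs) →
                                   All (λ rs → proj₂ rs < proj₁ rs) (f ∷ g ∷ fs) → ReducibleU p q (a , b)
  upward-factorization⇒reducible {a} {b} {f} {g} {fs} fact (s<r ∷ up)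
    with ∣p^n⇒≡p^i p-prime a (numerator∣ {p} {q} {a} {b} {f ∷ g ∷ fs} fact (here refl))
       | ∣p^n⇒≡p^i q-prime b (denominator∣ {p} {q} {a} {b} {f ∷ g ∷ fs} fact (here refl))
  ... | i , i≤a , refl | j , j≤b , refl =
    (i , j) , (a ∸ i , b ∸ j) , above⇒InU s<r ,
    above⇒InU (upward-factorization⇒above {p} {q} {a ∸ i} {b ∸ j}
                 (factorization-tail {p} {q} {a} {b} {i} {j} fact i≤a j≤b) up) ,
    cong₂ _,_ (sym (m+[n∸m]≡n i≤a)) (sym (m+[n∸m]≡n j≤b))

  factorization⇒reducible : ∀ {a b} fs → Above p q (a , b) →
                            NontrivialBiasedFactorization p q (a , b) fs → ReducibleU p q (a , b)
  factorization⇒reducible (f ∷ g ∷ fs) _  (fact , inj₁ up , _)   = upward-factorization⇒reducible fact up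
  factorization⇒reducible {a} {b} (f ∷ g ∷ fs) ab (fact , inj₂ down , _) =
    contradiction (downward-factorization⇒below {p} {q} {a} {b} fact down) (<-asym ab)
  factorization⇒reducible (_ ∷ []) _ (_ , _ , s≤s ())

  noNontrivialBiasedFactorization⇔irreducibleU : ∀ {a b} → InU p q (a , b) →
    NoNontrivialBiasedFactorization p q (a , b) ⇔ IrreducibleU p q (a , b)
  noNontrivialBiasedFactorization⇔irreducibleU ab∈U = mk⇔
    (λ none → ab∈U , none ∘ reducible⇒factorization)
    (λ (_ , irreducible) (fs , factorization) →
      irreducible (factorization⇒reducible fs (proj₂ ab∈U) factorization))

InN-swap : ∀ {a b} → InN (a , b) → InN (b , a)
InN-swap ab≢0 = ab≢0 ∘ swap

InL⇒InU-swap : ∀ {p q a b} → InL p q (a , b) → InU q p (b , a)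
InL⇒InU-swap (ab≢0 , pᵃ<qᵇ) = InN-swap ab≢0 , pᵃ<qᵇ

InG-swap : ∀ {a b} → InG (a , b) ⇔ InG (b , a)
InG-swap = mk⇔ flip flip
  where
  flip : ∀ {a b} → InG (a , b) → InG (b , a)
  flip {a} {b} (ab≢0 , gcd≡1) = InN-swap ab≢0 , trans (gcd-comm b a) gcd≡1

InL1⇔InU2-swap : ∀ {p q a b} → InL1 p q (a , b) ⇔ InU2 q p (b , a)
InL1⇔InU2-swap {p} {q} {a} {b} = mk⇔
  (λ (ab∈L , maximal) → InL⇒InU-swap ab∈L , λ n m nm∈U n≤b →
     subst₂ _≤_ (*-comm m b) (*-comm a n) (maximal m n (InL⇐InU-swap nm∈U) n≤b))
  (λ (ba∈U , minimal) → InL⇐InU-swap ba∈U , λ m n mn∈L m≤a →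
     subst₂ _≤_ (*-comm b m) (*-comm n a) (minimal n m (InL⇒InU-swap mn∈L) m≤a))
  where
  InL⇐InU-swap : ∀ {m n} → InU q p (n , m) → InL p q (m , n)
  InL⇐InU-swap (nm≢0 , pᵐ<qⁿ) = InN-swap nm≢0 , pᵐ<qⁿ

IrreducibleL⇔IrreducibleU-swap : ∀ {p q a b} → IrreducibleL p q (a , b) ⇔ IrreducibleU q p (b , a)
IrreducibleL⇔IrreducibleU-swap {p} {q} = mk⇔
  (λ (ab∈L , irreducible) → InL⇒InU-swap ab∈L , irreducible ∘ from-U)
  (λ ((ba≢0 , pᵃ<qᵇ) , irreducible) → (InN-swap ba≢0 , pᵃ<qᵇ) , irreducible ∘ to-U)
  where
  to-U : ∀ {a b} → ReducibleL p q (a , b) → ReducibleU q p (b , a)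
  to-U ((a₁ , b₁) , (a₂ , b₂) , (ab₁≢0 , l₁) , (ab₂≢0 , l₂) , ab≡) =
    (b₁ , a₁) , (b₂ , a₂) , (InN-swap ab₁≢0 , l₁) , (InN-swap ab₂≢0 , l₂) , cong swap ab≡
  from-U : ∀ {a b} → ReducibleU q p (b , a) → ReducibleL p q (a , b)
  from-U ((b₁ , a₁) , (b₂ , a₂) , (ba₁≢0 , l₁) , (ba₂≢0 , l₂) , ba≡) =
    (a₁ , b₁) , (a₂ , b₂) , (InN-swap ba₁≢0 , l₁) , (InN-swap ba₂≢0 , l₂) , cong swap ba≡

NoNontrivialBiasedFactorization-swap : ∀ {p q a b} →
  NoNontrivialBiasedFactorization p q (a , b) ⇔ NoNontrivialBiasedFactorization q p (b , a)
NoNontrivialBiasedFactorization-swap {p} {q} {a} {b} =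
  mk⇔ (_∘ invert {q} {p} {b} {a}) (_∘ invert {p} {q} {a} {b})
  where
  invert : ∀ {p q a b} → ∃[ fs ] NontrivialBiasedFactorization p q (a , b) fs →
           ∃[ fs ] NontrivialBiasedFactorization q p (b , a) fs
  invert {p} {q} {a} {b} (fs , factorization , biased , nontrivial) =
    map swap fs , IsFactorization-swap {p} {q} {a} {b} factorization , Biased-swap biased ,
    subst (2 ≤_) (sym (length-map swap fs)) nontrivial

lemma5p2 : (p q : ℕ) → Prime p → Prime q → p ≢ q → (a b : ℕ) →
    (InU p q (a , b) →
      (NoNontrivialBiasedFactorization p q (a , b) ⇔ IrreducibleU p q (a , b)) ×
      (IrreducibleU p q (a , b) ⇔ (InG (a , b) × InU2 p q (a , b)))) ×
    (InL p q (a , b) →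
      (NoNontrivialBiasedFactorization p q (a , b) ⇔ IrreducibleL p q (a , b)) ×
      (IrreducibleL p q (a , b) ⇔ (InG (a , b) × InL1 p q (a , b))))
lemma5p2 p q p-prime q-prime p≢q a b =
  (λ ab∈U → Factorizations.noNontrivialBiasedFactorization⇔irreducibleU p-prime q-prime p≢q ab∈U ,
            Irreducibility.irreducibleU⇔InG×InU2 p q (prime>1 p-prime)) ,
  (λ ab∈L →
     ⇔.trans (NoNontrivialBiasedFactorization-swap {p} {q} {a} {b})
       (⇔.trans (Factorizations.noNontrivialBiasedFactorization⇔irreducibleU q-prime p-prime (≢-sym p≢q)
                   (InL⇒InU-swap ab∈L))
                (⇔.sym IrreducibleL⇔IrreducibleU-swap)) ,
     ⇔.trans IrreducibleL⇔IrreducibleU-swap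
       (⇔.trans (Irreducibility.irreducibleU⇔InG×InU2 q p (prime>1 q-prime))
                (⇔.sym (InG-swap ×-⇔ InL1⇔InU2-swap))))
  where
  prime>1 : ∀ {r} → Prime r → 1 < r
  prime>1 {r} r-prime = nonTrivial⇒n>1 r {{prime⇒nonTrivial r-prime}}
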